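{- Let $G$ be a graph, let $x,y$ be distinct vertices of $G$, and let $G^*$ be obtained from $G$ by adding the edge $xy$ if it is not present, or removing it if it is present. Then $\mathrm{czf}(G)-\mathrm{czf}(G^*)\in\{ -1,0,1\}$.
   Context: All graphs are finite and simple. Constrained zero forcing: start with a set $S\subseteq V(G)$ of colored vertices, all others uncolored. A colored vertex $c$ may force an uncolored vertex $u$ to become colored if $u$ is the only uncolored neighbor of $c$; only vertices of the initial set $S$ may ever force. $S$ is a constrained zero forcing set if some sequence of forces colors all vertices. $\mathrm{czf}(G)$ is the minimum size of a constrained zero forcing set. -}

module Defs where

open import Data.Nat using (ℕ; _≤_; suc)
open import Data.Bool using (Bool; true; false; not; if_then_else_)
open import Data.Fin using (Fin; _≟_)
open import Data.Fin.Subset using (Subset; _∈_; _∉_; _∪_; ⁅_⁆; ∣_∣)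
open import Data.Product using (Σ; _×_; _,_)
open import Data.Sum using (_⊎_; inj₁; inj₂)
open import Relation.Nullary using (¬_; Dec; yes; no)
open import Relation.Nullary.Decidable using (⌊_⌋)
open import Relation.Binary.PropositionalEquality using (_≡_; _≢_; refl)
open import Data.Bool using (_∧_; _∨_)

record Graph (n : ℕ) : Set where
  field
    adj   : Fin n → Fin n → Bool
    adj-sym : ∀ u v → adj u v ≡ adj v u
    irrefl : ∀ u → adj u u ≡ false
open Graph public

samePair : ∀ {n} → Fin n → Fin n → Fin n → Fin n → Bool
samePair x y a b = (⌊ a ≟ x ⌋ ∧ ⌊ b ≟ y ⌋) ∨ (⌊ a ≟ y ⌋ ∧ ⌊ b ≟ x ⌋)

toggleAdj : ∀ {n} → (Fin n → Fin n → Bool) → Fin n → Fin n → Fin n → Fin n → Bool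
toggleAdj A x y a b = if samePair x y a b then not (A a b) else A a b

private
  ∨-comm : ∀ p q → (p ∨ q) ≡ (q ∨ p)
  ∨-comm false false = refl
  ∨-comm false true = refl
  ∨-comm true false = refl
  ∨-comm true true = refl

  ∧-comm : ∀ p q → (p ∧ q) ≡ (q ∧ p)
  ∧-comm false false = refl
  ∧-comm false true = refl
  ∧-comm true false = refl
  ∧-comm true true = refl

  samePair-sym : ∀ {n} (x y a b : Fin n) → samePair x y a b ≡ samePair x y b a
  samePair-sym x y a b
    rewrite ∧-comm ⌊ a ≟ x ⌋ ⌊ b ≟ y ⌋ | ∧-comm ⌊ a ≟ y ⌋ ⌊ b ≟ x ⌋
    = ∨-comm (⌊ b ≟ y ⌋ ∧ ⌊ a ≟ x ⌋) (⌊ b ≟ x ⌋ ∧ ⌊ a ≟ y ⌋)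

  samePair-diag : ∀ {n} (x y a : Fin n) → x ≢ y → samePair x y a a ≡ false
  samePair-diag x y a x≢y with a ≟ x | a ≟ y
  ... | yes refl | yes refl = Data.Empty.⊥-elim (x≢y refl)
    where import Data.Empty
  ... | yes _ | no _ = refl
  ... | no _ | yes _ = refl
  ... | no _ | no _ = refl

toggle : ∀ {n} → Graph n → (x y : Fin n) → x ≢ y → Graph n
toggle G x y x≢y = record
  { adj = toggleAdj (adj G) x y
  ; adj-sym = λ u v → symProof u v
  ; irrefl = λ u → irrProof u
  }
  where
  symProof : ∀ u v → toggleAdj (adj G) x y u v ≡ toggleAdj (adj G) x y v u
  symProof u v rewrite samePair-sym x y u v | Graph.adj-sym G u v = refl
  irrProof : ∀ u → toggleAdj (adj G) x y u u ≡ false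
  irrProof u rewrite samePair-diag x y u x≢y = Graph.irrefl G u

-- One constrained force: with initial set S and current colored set C,
-- a vertex c ∈ S that is colored forces its unique uncolored neighbour u.
data Force {n} (G : Graph n) (S C : Subset n) : Subset n → Set where
  force : (c u : Fin n) → c ∈ S → c ∈ C → u ∉ C → adj G c u ≡ true →
          (∀ w → adj G c w ≡ true → w ≢ u → w ∈ C) →
          Force G S C (C ∪ ⁅ u ⁆)

data Reach {n} (G : Graph n) (S : Subset n) : Subset n → Set where
  start : Reach G S S
  step  : ∀ {C C'} → Reach G S C → Force G S C C' → Reach G S C'

IsCZFS : ∀ {n} → Graph n → Subset n → Set
IsCZFS G S = Σ (Subset _) λ C → Reach G S C × (∀ v → v ∈ C)

IsCzf : ∀ {n} → Graph n → ℕ → Set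
IsCzf G k = (Σ (Subset _) λ S → IsCZFS G S × ∣ S ∣ ≡ k)
          × (∀ S → IsCZFS G S → k ≤ ∣ S ∣)

-- If S is a constrained zero forcing set of G, enlarge it by one endpoint of the
-- toggled pair {x, y} so that whenever one endpoint is initially colored, so is
-- the other. An initial vertex c then sees the same neighbours in G and G*
-- outside the initially colored set, so every force c → u of G is either a force
-- of G* or has u already colored. Hence czf(G*) ≤ czf(G) + 1, and symmetrically.
{-# OPTIONS --safe #-}
module Submission where

open import Defs
open import Data.Nat using (ℕ; _≤_; _+_; suc; z≤n; s≤s)
open import Data.Nat.Properties using (≤-trans; +-comm; +-suc; m≤n⇒m≤1+n)
open import Data.Fin using (Fin; _≟_)
open import Data.Fin.Subset using (Subset; _∈_; _∉_; _⊆_; _∪_; ⁅_⁆; ∣_∣; inside; outside)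
open import Data.Fin.Subset.Properties
  using (_∈?_; x∈⁅x⁆; x∈⁅y⁆⇒x≡y; p⊆p∪q; q⊆p∪q; x∈p∪q⁻; ∣⁅x⁆∣≡1)
open import Data.Bool using (true; false)
open import Data.Vec using ([]; _∷_)
open import Data.Product using (Σ; _×_; _,_)
open import Data.Sum using (_⊎_; inj₁; inj₂; [_,_])
open import Data.Empty using (⊥-elim)
open import Function using (_∘_)
open import Relation.Nullary using (¬_; yes; no)
open import Relation.Binary.PropositionalEquality using (_≡_; _≢_; refl; sym; subst)

∣p∪q∣≤∣p∣+∣q∣ : ∀ {n} (p q : Subset n) → ∣ p ∪ q ∣ ≤ ∣ p ∣ + ∣ q ∣
∣p∪q∣≤∣p∣+∣q∣ []            []            = z≤n
∣p∪q∣≤∣p∣+∣q∣ (outside ∷ p) (outside ∷ q) = ∣p∪q∣≤∣p∣+∣q∣ p q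
∣p∪q∣≤∣p∣+∣q∣ (inside  ∷ p) (outside ∷ q) = s≤s (∣p∪q∣≤∣p∣+∣q∣ p q)
∣p∪q∣≤∣p∣+∣q∣ (outside ∷ p) (inside  ∷ q) =
  subst (suc ∣ p ∪ q ∣ ≤_) (sym (+-suc ∣ p ∣ ∣ q ∣)) (s≤s (∣p∪q∣≤∣p∣+∣q∣ p q))
∣p∪q∣≤∣p∣+∣q∣ (inside  ∷ p) (inside  ∷ q) =
  s≤s (subst (∣ p ∪ q ∣ ≤_) (sym (+-suc ∣ p ∣ ∣ q ∣)) (m≤n⇒m≤1+n (∣p∪q∣≤∣p∣+∣q∣ p q)))

∣p∪⁅x⁆∣≤1+∣p∣ : ∀ {n} (p : Subset n) (x : Fin n) → ∣ p ∪ ⁅ x ⁆ ∣ ≤ suc ∣ p ∣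
∣p∪⁅x⁆∣≤1+∣p∣ p x = subst (∣ p ∪ ⁅ x ⁆ ∣ ≤_) eq (∣p∪q∣≤∣p∣+∣q∣ p ⁅ x ⁆)
  where
  eq : ∣ p ∣ + ∣ ⁅ x ⁆ ∣ ≡ suc ∣ p ∣
  eq rewrite ∣⁅x⁆∣≡1 x = +-comm ∣ p ∣ 1

p∪⁅x⁆⊆q : ∀ {n} {p q : Subset n} {x : Fin n} → p ⊆ q → x ∈ q → p ∪ ⁅ x ⁆ ⊆ q
p∪⁅x⁆⊆q {p = p} {q} {x} p⊆q x∈q =
  [ p⊆q , (λ y∈⁅x⁆ → subst (_∈ q) (sym (x∈⁅y⁆⇒x≡y x y∈⁅x⁆)) x∈q) ] ∘ x∈p∪q⁻ p ⁅ x ⁆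

initial⊆reach : ∀ {n} {G : Graph n} {S C : Subset n} → Reach G S C → S ⊆ C
initial⊆reach start                          = λ v∈S → v∈S
initial⊆reach (step r (force _ _ _ _ _ _ _)) = p⊆p∪q _ ∘ initial⊆reach r

module Simulation {n} {G H : Graph n} {S S' : Subset n} (S⊆S' : S ⊆ S')
  (agree : ∀ {c w} → c ∈ S → w ∉ S' → adj G c w ≡ adj H c w) where

  reach-simulate : ∀ {C} → Reach G S C → Σ (Subset n) λ D → Reach H S' D × C ⊆ D
  reach-simulate start = S' , start , S⊆S'
  reach-simulate (step {C} r (force c u c∈S c∈C u∉C cu nbrs)) with reach-simulate r
  ... | D , rD , C⊆D with u ∈? D
  ...   | yes u∈D = D , rD , p∪⁅x⁆⊆q C⊆D u∈D
  ...   | no  u∉D =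
    D ∪ ⁅ u ⁆ , step rD (force c u (S⊆S' c∈S) (C⊆D c∈C) u∉D cuH nbrsH) ,
    p∪⁅x⁆⊆q (p⊆p∪q _ ∘ C⊆D) (q⊆p∪q D ⁅ u ⁆ (x∈⁅x⁆ u))
    where
    outside-D : ∀ {w} → w ∉ D → adj G c w ≡ adj H c w
    outside-D w∉D = agree c∈S (w∉D ∘ initial⊆reach rD)

    cuH : adj H c u ≡ true
    cuH = subst (_≡ true) (outside-D u∉D) cu

    nbrsH : ∀ w → adj H c w ≡ true → w ≢ u → w ∈ D
    nbrsH w cw w≢u with w ∈? D
    ... | yes w∈D = w∈D
    ... | no  w∉D = C⊆D (nbrs w (subst (_≡ true) (sym (outside-D w∉D)) cw) w≢u)

  czfs-simulate : IsCZFS G S → IsCZFS H S'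
  czfs-simulate (C , r , full) with reach-simulate r
  ... | D , rD , C⊆D = D , rD , C⊆D ∘ full

SamePair : ∀ {n} → Fin n → Fin n → Fin n → Fin n → Set
SamePair x y a b = (a ≡ x × b ≡ y) ⊎ (a ≡ y × b ≡ x)

samePair-true : ∀ {n} {x y a b : Fin n} → samePair x y a b ≡ true → SamePair x y a b
samePair-true {x = x} {y} {a} {b} eq with a ≟ x | b ≟ y | a ≟ y | b ≟ x
... | yes a≡x | yes b≡y | _       | _       = inj₁ (a≡x , b≡y)
... | _       | _       | yes a≡y | yes b≡x = inj₂ (a≡y , b≡x)
... | no _    | _       | no _    | _       with () ← eq
... | no _    | _       | yes _   | no _    with () ← eq
... | yes _   | no _    | no _    | _       with () ← eq
... | yes _   | no _    | yes _   | no _    with () ← eq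

AgreeOffPair : ∀ {n} → Graph n → Graph n → Fin n → Fin n → Set
AgreeOffPair G H x y = ∀ {a b} → ¬ SamePair x y a b → adj G a b ≡ adj H a b

toggle-agreeOffPair : ∀ {n} (G : Graph n) (x y : Fin n) (x≢y : x ≢ y) →
                      AgreeOffPair G (toggle G x y x≢y) x y
toggle-agreeOffPair G x y x≢y {a} {b} ¬xy with samePair x y a b in eq
... | true  = ⊥-elim (¬xy (samePair-true eq))
... | false = refl

pairClosure : ∀ {n} (x y : Fin n) (S : Subset n) →
              Σ (Subset n) λ S' → S ⊆ S' × (x ∈ S → y ∈ S') × (y ∈ S → x ∈ S')
                                 × ∣ S' ∣ ≤ suc ∣ S ∣
pairClosure x y S with x ∈? S
... | yes x∈S = S ∪ ⁅ y ⁆ , p⊆p∪q _ , (λ _ → q⊆p∪q S _ (x∈⁅x⁆ y)) , (λ _ → p⊆p∪q _ x∈S)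
                , ∣p∪⁅x⁆∣≤1+∣p∣ S y
... | no  x∉S = S ∪ ⁅ x ⁆ , p⊆p∪q _ , (⊥-elim ∘ x∉S) , (λ _ → q⊆p∪q S _ (x∈⁅x⁆ x))
                , ∣p∪⁅x⁆∣≤1+∣p∣ S x

czfs-acrossPair : ∀ {n} {G H : Graph n} {x y : Fin n} → AgreeOffPair G H x y →
                  ∀ {S} → IsCZFS G S → Σ (Subset n) λ S' → IsCZFS H S' × ∣ S' ∣ ≤ suc ∣ S ∣
czfs-acrossPair {G = G} {H} {x} {y} agreeOff {S} zfs with pairClosure x y S
... | S' , S⊆S' , x→y , y→x , ∣S'∣≤ = S' , Simulation.czfs-simulate S⊆S' agree zfs , ∣S'∣≤
  where
  agree : ∀ {c w} → c ∈ S → w ∉ S' → adj G c w ≡ adj H c w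
  agree c∈S w∉S' = agreeOff λ where
    (inj₁ (refl , refl)) → w∉S' (x→y c∈S)
    (inj₂ (refl , refl)) → w∉S' (y→x c∈S)

czf-acrossPair : ∀ {n} {G H : Graph n} {x y : Fin n} → AgreeOffPair G H x y →
                 ∀ {k k*} → IsCzf G k → IsCzf H k* → k* ≤ suc k
czf-acrossPair agreeOff ((S , zfs , ∣S∣≡k) , _) (_ , minimal) with czfs-acrossPair agreeOff zfs
... | S' , zfs' , ∣S'∣≤ = subst (λ m → _ ≤ suc m) ∣S∣≡k (≤-trans (minimal S' zfs') ∣S'∣≤)

mainTheorem6 : ∀ {n} (G : Graph n) (x y : Fin n) (x≢y : x ≢ y) (k k* : ℕ) →
                 IsCzf G k → IsCzf (toggle G x y x≢y) k* →
                 (k ≤ suc k*) × (k* ≤ suc k)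
mainTheorem6 G x y x≢y k k* czfG czfG* =
  czf-acrossPair (sym ∘ agreeOff) czfG* czfG , czf-acrossPair agreeOff czfG czfG*
  where
  agreeOff : AgreeOffPair G (toggle G x y x≢y) x y
  agreeOff = toggle-agreeOffPair G x y x≢y
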